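{- Let $I_0,I_1$ be perfect chains and $\iota:I_0\to I_1$ an injective map preserving all joins and all meets, with left adjoint $\ell:I_1\to I_0$. For $f\in\mathcal{Q}_\vee(I_0)$ put $R_\iota(f):=\iota\circ f\circ\ell$. Then $R_\iota$ maps $\mathcal{Q}_\vee(I_0)$ into $\mathcal{Q}_\vee(I_1)$ and is an embedding of lattice-ordered bisemigroups, i.e. it is injective and preserves finite meets, joins, $\otimes$ and $\oplus$. Moreover $R_{\mathrm{id}_{I_0}}=\mathrm{id}$ and $R_{\iota_2\circ\iota_1}=R_{\iota_2}\circ R_{\iota_1}$ for composable such embeddings $\iota_1,\iota_2$, so $\mathcal{Q}_\vee(-)$ together with $R_{(-)}$ is a functor from the category of perfect chains and such embeddings to the category of lattice-ordered bisemigroups.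
   Context: For a complete chain $I$, $\mathcal{Q}_\vee(I)$ (resp. $\mathcal{Q}_\wedge(I)$) is the set of functions $I\to I$ preserving all joins (resp. all meets), ordered pointwise. For monotone $f$, $f^{\wedge}(x)=\bigwedge_{x<x'}f(x')$ and $f_{\vee}(x)=\bigvee_{x'<x}f(x')$. $I$ is perfect if $f\mapsto f^\wedge$ and $g\mapsto g_\vee$ are mutually inverse order isomorphisms between $\mathcal{Q}_\vee(I)$ and $\mathcal{Q}_\wedge(I)$. On $\mathcal{Q}_\vee(I)$: $f\otimes g:=g\circ f$, $f^{*}(x):=\bigvee\{y\in I: f(y)<x\}$, $f\oplus g:=(g^{*}\otimes f^{*})^{*}$. The left adjoint of $\iota$ is $\ell(y)=\bigwedge\{x\in I_0: y\le\iota(x)\}$. A lattice-ordered bisemigroup is a bounded lattice with an associative $\otimes$ distributing over finite joins, an associative $\oplus$ distributing over finite meets, satisfying $\beta\otimes(\gamma\oplus\delta)\le(\beta\otimes\gamma)\oplus\delta$ and $(\alpha\oplus\beta)\otimes\gamma\le\alpha\oplus(\beta\otimes\gamma)$; morphisms are lattice homomorphisms preserving $\otimes,\oplus$. -}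

module Defs where

open import Data.Product using (Σ; ∃; _×_; _,_)
open import Relation.Nullary using (¬_)
open import Relation.Binary.PropositionalEquality using (_≡_; _≢_; _≗_)
open import Relation.Binary.Structures using (IsTotalOrder)
open import Function using (_∘_; id; Injective)

record CompleteChain : Set₁ where
  field
    Carrier      : Set
    _≤_          : Carrier → Carrier → Set
    isTotalOrder : IsTotalOrder _≡_ _≤_
    ⋁            : (Carrier → Set) → Carrier
    ⋁-upper      : ∀ P x → P x → x ≤ ⋁ P
    ⋁-least      : ∀ P u → (∀ x → P x → x ≤ u) → ⋁ P ≤ u

  _<_ : Carrier → Carrier → Set
  x < y = (x ≤ y) × (x ≢ y)

  ⋀ : (Carrier → Set) → Carrier
  ⋀ P = ⋁ (λ y → ∀ x → P x → y ≤ x)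

open CompleteChain public

module _ (I : CompleteChain) where
  private
    C = Carrier I

  Image : (C → C) → (C → Set) → C → Set
  Image f P y = ∃ λ x → P x × (f x ≡ y)

  -- f preserves all joins (element of Q_∨(I))
  PreservesJoins : (C → C) → Set₁
  PreservesJoins f = ∀ (P : C → Set) → f (⋁ I P) ≡ ⋁ I (Image f P)

  PreservesMeets : (C → C) → Set₁
  PreservesMeets f = ∀ (P : C → Set) → f (⋀ I P) ≡ ⋀ I (Image f P)

  _≤ᶠ_ : (C → C) → (C → C) → Set
  f ≤ᶠ g = ∀ x → _≤_ I (f x) (g x)

  up : (C → C) → C → C
  up f x = ⋀ I (λ y → ∃ λ x' → _<_ I x x' × (f x' ≡ y))

  down : (C → C) → C → C
  down f x = ⋁ I (λ y → ∃ λ x' → _<_ I x' x × (f x' ≡ y))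

  record Perfect : Set₁ where
    field
      up-Q∧      : ∀ f → PreservesJoins f → PreservesMeets (up f)
      down-Q∨    : ∀ g → PreservesMeets g → PreservesJoins (down g)
      down-up    : ∀ f → PreservesJoins f → down (up f) ≗ f
      up-down    : ∀ g → PreservesMeets g → up (down g) ≗ g
      up-mono    : ∀ f f' → PreservesJoins f → PreservesJoins f' →
                   f ≤ᶠ f' → up f ≤ᶠ up f'
      down-mono  : ∀ g g' → PreservesMeets g → PreservesMeets g' →
                   g ≤ᶠ g' → down g ≤ᶠ down g'

  _⊗_ : (C → C) → (C → C) → C → C
  (f ⊗ g) = g ∘ f

  _* : (C → C) → C → C
  (f *) x = ⋁ I (λ y → _<_ I (f y) x)

  _⊕_ : (C → C) → (C → C) → C → C
  f ⊕ g = ((g *) ⊗ (f *)) *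

  -- lattice structure of Q_∨(I) with the pointwise order,
  -- expressed via greatest lower / least upper bounds inside Q_∨(I)
  IsMeetQ : (C → C) → (C → C) → (C → C) → Set₁
  IsMeetQ f g h = PreservesJoins h × h ≤ᶠ f × h ≤ᶠ g ×
    (∀ k → PreservesJoins k → k ≤ᶠ f → k ≤ᶠ g → k ≤ᶠ h)

  IsJoinQ : (C → C) → (C → C) → (C → C) → Set₁
  IsJoinQ f g h = PreservesJoins h × f ≤ᶠ h × g ≤ᶠ h ×
    (∀ k → PreservesJoins k → f ≤ᶠ k → g ≤ᶠ k → h ≤ᶠ k)

  IsTopQ : (C → C) → Set₁
  IsTopQ h = PreservesJoins h × (∀ k → PreservesJoins k → k ≤ᶠ h)

  IsBotQ : (C → C) → Set₁
  IsBotQ h = PreservesJoins h × (∀ k → PreservesJoins k → h ≤ᶠ k)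

record ChainEmbedding (I₀ I₁ : CompleteChain) : Set₁ where
  field
    ι           : Carrier I₀ → Carrier I₁
    injective   : Injective _≡_ _≡_ ι
    pres-joins  : ∀ (P : Carrier I₀ → Set) → ι (⋁ I₀ P) ≡ ⋁ I₁ (λ y → ∃ λ x → P x × (ι x ≡ y))
    pres-meets  : ∀ (P : Carrier I₀ → Set) → ι (⋀ I₀ P) ≡ ⋀ I₁ (λ y → ∃ λ x → P x × (ι x ≡ y))

open ChainEmbedding public

leftAdj : ∀ {I₀ I₁} → ChainEmbedding I₀ I₁ → Carrier I₁ → Carrier I₀
leftAdj {I₀} {I₁} e y = ⋀ I₀ (λ x → _≤_ I₁ y (ι e x))

R : ∀ {I₀ I₁} → ChainEmbedding I₀ I₁ → (Carrier I₀ → Carrier I₀) → Carrier I₁ → Carrier I₁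
R e f = ι e ∘ f ∘ leftAdj e

-- Since ι preserves all meets, ℓ is a genuine left adjoint: ℓ y ≤ x ⇔ y ≤ ι x,
-- and injectivity of ι gives ℓ ∘ ι = id.  Hence R_ι(g) ⊗ R_ι(f) collapses to
-- ι ∘ g ∘ f ∘ ℓ, and the strict version ι a < y ⇔ a < ℓ y of the adjunction
-- shows that R_ι commutes with the pseudo-complement f ↦ f*, so it preserves
-- ⊕ = (g* ⊗ f*)*.  On the order side, k ≤ R_ι(h) ⇔ ℓ ∘ k ∘ ι ≤ h for
-- join-preserving k, so greatest lower bounds in Q_∨(I₀) are carried to
-- greatest lower bounds in Q_∨(I₁); least upper bounds are pointwise binary
-- joins, which ι preserves.
module Submission where

open import Defs
open import Data.Product using (Σ; ∃; _×_; _,_)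
open import Data.Sum using (_⊎_; inj₁; inj₂)
open import Data.Empty using (⊥; ⊥-elim)
open import Relation.Binary.PropositionalEquality
  using (_≡_; _≗_; refl; sym; trans; cong; subst; module ≡-Reasoning)
open import Relation.Binary.Structures using (IsTotalOrder)
open import Function using (_∘_; id)

module ChainProperties (I : CompleteChain) where
  open IsTotalOrder (isTotalOrder I) public
    using (reflexive; antisym; total)
    renaming (refl to ≤-refl; trans to ≤-trans)

  private
    C : Set
    C = Carrier I
    _≤ᴵ_ : C → C → Set
    _≤ᴵ_ = _≤_ I

  ⋁-mono : ∀ (P Q : C → Set) → (∀ x → P x → Q x) → ⋁ I P ≤ᴵ ⋁ I Q
  ⋁-mono P Q P⊆Q = ⋁-least I P (⋁ I Q) (λ x px → ⋁-upper I Q x (P⊆Q x px))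

  ⋁-cong : ∀ (P Q : C → Set) → (∀ x → P x → Q x) → (∀ x → Q x → P x) →
           ⋁ I P ≡ ⋁ I Q
  ⋁-cong P Q P⊆Q Q⊆P = antisym (⋁-mono P Q P⊆Q) (⋁-mono Q P Q⊆P)

  ⋀-lower : ∀ (P : C → Set) x → P x → ⋀ I P ≤ᴵ x
  ⋀-lower P x px = ⋁-least I _ x (λ y y≤P → y≤P x px)

  ⋀-greatest : ∀ (P : C → Set) u → (∀ x → P x → u ≤ᴵ x) → u ≤ᴵ ⋀ I P
  ⋀-greatest P u = ⋁-upper I _ u

  ⋀-cong : ∀ (P Q : C → Set) → (∀ x → P x → Q x) → (∀ x → Q x → P x) →
           ⋀ I P ≡ ⋀ I Q
  ⋀-cong P Q P⊆Q Q⊆P =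
    ⋁-cong _ _ (λ y y≤P x qx → y≤P x (Q⊆P x qx)) (λ y y≤Q x px → y≤Q x (P⊆Q x px))

  ⋀-≤-upwardClosure : ∀ y → ⋀ I (y ≤ᴵ_) ≡ y
  ⋀-≤-upwardClosure y = antisym (⋀-lower _ y ≤-refl) (⋀-greatest _ y (λ _ y≤x → y≤x))

  ⊥ᴵ : C
  ⊥ᴵ = ⋁ I (λ _ → ⊥)

  ⊥ᴵ-least : ∀ x → ⊥ᴵ ≤ᴵ x
  ⊥ᴵ-least x = ⋁-least I _ x (λ _ ())

  _⊔_ : C → C → C
  a ⊔ b = ⋁ I (λ z → z ≡ a ⊎ z ≡ b)

  x≤x⊔y : ∀ a b → a ≤ᴵ (a ⊔ b)
  x≤x⊔y a b = ⋁-upper I _ a (inj₁ refl)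

  y≤x⊔y : ∀ a b → b ≤ᴵ (a ⊔ b)
  y≤x⊔y a b = ⋁-upper I _ b (inj₂ refl)

  ⊔-least : ∀ a b u → a ≤ᴵ u → b ≤ᴵ u → (a ⊔ b) ≤ᴵ u
  ⊔-least a b u a≤u b≤u = ⋁-least I _ u λ { z (inj₁ refl) → a≤u ; z (inj₂ refl) → b≤u }

  x≤y⇒x⊔y≡y : ∀ a b → a ≤ᴵ b → (a ⊔ b) ≡ b
  x≤y⇒x⊔y≡y a b a≤b = antisym (⊔-least a b b a≤b ≤-refl) (y≤x⊔y a b)

JoinPreserving : (A B : CompleteChain) → (Carrier A → Carrier B) → Set₁
JoinPreserving A B f = ∀ P → f (⋁ A P) ≡ ⋁ B (λ y → ∃ λ x → P x × f x ≡ y)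

MeetPreserving : (A B : CompleteChain) → (Carrier A → Carrier B) → Set₁
MeetPreserving A B f = ∀ P → f (⋀ A P) ≡ ⋀ B (λ y → ∃ λ x → P x × f x ≡ y)

module _ {A B : CompleteChain} {f : Carrier A → Carrier B} (f-joins : JoinPreserving A B f) where
  private
    module A = ChainProperties A
    module B = ChainProperties B

  joinPreserving-⊔ : ∀ a b → f (a A.⊔ b) ≡ f a B.⊔ f b
  joinPreserving-⊔ a b = trans (f-joins _) (B.⋁-cong _ _
    (λ { z (x , inj₁ refl , refl) → inj₁ refl ; z (x , inj₂ refl , refl) → inj₂ refl })
    (λ { z (inj₁ refl) → a , inj₁ refl , refl ; z (inj₂ refl) → b , inj₂ refl , refl }))

  joinPreserving-⊥ : f A.⊥ᴵ ≡ B.⊥ᴵ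
  joinPreserving-⊥ = trans (f-joins _) (B.antisym
    (⋁-least B _ B.⊥ᴵ (λ { z (x , () , refl) })) (B.⊥ᴵ-least _))

  joinPreserving⇒monotone : ∀ x y → _≤_ A x y → _≤_ B (f x) (f y)
  joinPreserving⇒monotone x y x≤y = subst (_≤_ B (f x) ∘ f) (A.x≤y⇒x⊔y≡y x y x≤y)
    (subst (_≤_ B (f x)) (sym (joinPreserving-⊔ x y)) (B.x≤x⊔y (f x) (f y)))

∘-joinPreserving : ∀ {A B D} {f : Carrier A → Carrier B} {g : Carrier B → Carrier D} →
                   JoinPreserving A B f → JoinPreserving B D g →
                   JoinPreserving A D (g ∘ f)
∘-joinPreserving {D = D} {f} {g} f-joins g-joins P =
  trans (cong g (f-joins P)) (trans (g-joins _) (ChainProperties.⋁-cong D _ _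
    (λ { z (y , (x , px , refl) , refl) → x , px , refl })
    (λ { z (x , px , refl) → f x , (x , px , refl) , refl })))

∘-meetPreserving : ∀ {A B D} {f : Carrier A → Carrier B} {g : Carrier B → Carrier D} →
                   MeetPreserving A B f → MeetPreserving B D g →
                   MeetPreserving A D (g ∘ f)
∘-meetPreserving {D = D} {f} {g} f-meets g-meets P =
  trans (cong g (f-meets P)) (trans (g-meets _) (ChainProperties.⋀-cong D _ _
    (λ { z (y , (x , px , refl) , refl) → x , px , refl })
    (λ { z (x , px , refl) → f x , (x , px , refl) , refl })))

⊔ᶠ-joinPreserving : ∀ I {f g : Carrier I → Carrier I} →
                    PreservesJoins I f → PreservesJoins I g →
                    PreservesJoins I (λ x → ChainProperties._⊔_ I (f x) (g x))
⊔ᶠ-joinPreserving I {f} {g} f-joins g-joins P = antisym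
  (⊔-least _ _ _ (dominated-at-⋁ f-joins (λ x → x≤x⊔y _ _)) (dominated-at-⋁ g-joins (λ x → y≤x⊔y _ _)))
  (⋁-least I _ _ λ { z (x , px , refl) → ⊔-least _ _ _
    (≤-trans (f-monotone _ _ (⋁-upper I P x px)) (x≤x⊔y _ _))
    (≤-trans (g-monotone _ _ (⋁-upper I P x px)) (y≤x⊔y _ _)) })
  where
  open ChainProperties I
  f⊔g : Carrier I → Carrier I
  f⊔g x = f x ⊔ g x
  f-monotone : ∀ x y → _≤_ I x y → _≤_ I (f x) (f y)
  f-monotone = joinPreserving⇒monotone {I} {I} {f} f-joins
  g-monotone : ∀ x y → _≤_ I x y → _≤_ I (g x) (g y)
  g-monotone = joinPreserving⇒monotone {I} {I} {g} g-joins
  dominated-at-⋁ : ∀ {h} → PreservesJoins I h → _≤ᶠ_ I h f⊔g →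
                   _≤_ I (h (⋁ I P)) (⋁ I (Image I f⊔g P))
  dominated-at-⋁ h-joins h≤f⊔g = subst (λ w → _≤_ I w _) (sym (h-joins P))
    (⋁-least I _ _ λ { z (x , px , refl) → ≤-trans (h≤f⊔g x) (⋁-upper I _ _ (x , px , refl)) })

const-⊥-joinPreserving : ∀ I → PreservesJoins I (λ _ → ChainProperties.⊥ᴵ I)
const-⊥-joinPreserving I P = antisym (⊥ᴵ-least _) (⋁-least I _ _ λ { z (x , px , refl) → ≤-refl })
  where open ChainProperties I

⊗-cong : ∀ I {f f₁ g g₁ : Carrier I → Carrier I} → f ≗ f₁ → g ≗ g₁ →
         _⊗_ I f g ≗ _⊗_ I f₁ g₁
⊗-cong I {f₁ = f₁} {g} f≗f₁ g≗g₁ x = trans (cong g (f≗f₁ x)) (g≗g₁ (f₁ x))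

*-cong : ∀ I {f g : Carrier I → Carrier I} → f ≗ g → _* I f ≗ _* I g
*-cong I f≗g x = ChainProperties.⋁-cong I _ _
  (λ y fy<x → subst (λ w → _<_ I w x) (f≗g y) fy<x)
  (λ y gy<x → subst (λ w → _<_ I w x) (sym (f≗g y)) gy<x)

module Embedding {I₀ I₁ : CompleteChain} (e : ChainEmbedding I₀ I₁) where
  private
    module A = ChainProperties I₀
    module B = ChainProperties I₁
    C₀ C₁ : Set
    C₀ = Carrier I₀
    C₁ = Carrier I₁
    _≤₀_ : C₀ → C₀ → Set
    _≤₀_ = _≤_ I₀
    _≤₁_ : C₁ → C₁ → Set
    _≤₁_ = _≤_ I₁
    ℓ : C₁ → C₀
    ℓ = leftAdj e

  ι-monotone : ∀ x y → x ≤₀ y → ι e x ≤₁ ι e y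
  ι-monotone = joinPreserving⇒monotone {I₀} {I₁} {ι e} (pres-joins e)

  ι-reflects-≤ : ∀ x y → ι e x ≤₁ ι e y → x ≤₀ y
  ι-reflects-≤ x y ιx≤ιy with A.total x y
  ... | inj₁ x≤y = x≤y
  ... | inj₂ y≤x = A.reflexive (injective e (B.antisym ιx≤ιy (ι-monotone y x y≤x)))

  ≤-ι-leftAdj : ∀ y → y ≤₁ ι e (ℓ y)
  ≤-ι-leftAdj y = subst (y ≤₁_) (sym (pres-meets e _))
    (B.⋀-greatest _ y (λ { z (x , y≤ιx , refl) → y≤ιx }))

  ≤-ι⇒leftAdj-≤ : ∀ y x → y ≤₁ ι e x → ℓ y ≤₀ x
  ≤-ι⇒leftAdj-≤ y x = A.⋀-lower _ x

  leftAdj-≤⇒≤-ι : ∀ y x → ℓ y ≤₀ x → y ≤₁ ι e x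
  leftAdj-≤⇒≤-ι y x ℓy≤x = B.≤-trans (≤-ι-leftAdj y) (ι-monotone _ _ ℓy≤x)

  leftAdj-ι : ∀ x → ℓ (ι e x) ≡ x
  leftAdj-ι x = A.antisym (≤-ι⇒leftAdj-≤ (ι e x) x B.≤-refl)
    (A.⋀-greatest _ x (ι-reflects-≤ x))

  leftAdj-monotone : ∀ y y′ → y ≤₁ y′ → ℓ y ≤₀ ℓ y′
  leftAdj-monotone y y′ y≤y′ = ≤-ι⇒leftAdj-≤ y (ℓ y′) (B.≤-trans y≤y′ (≤-ι-leftAdj y′))

  leftAdj-joinPreserving : JoinPreserving I₁ I₀ ℓ
  leftAdj-joinPreserving P = A.antisym
    (≤-ι⇒leftAdj-≤ _ _ (⋁-least I₁ P _ λ y py →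
      leftAdj-≤⇒≤-ι y _ (⋁-upper I₀ _ (ℓ y) (y , py , refl))))
    (⋁-least I₀ _ _ λ { z (y , py , refl) → leftAdj-monotone y _ (⋁-upper I₁ P y py) })

  ι-<⇒<-leftAdj : ∀ a y → _<_ I₁ (ι e a) y → _<_ I₀ a (ℓ y)
  ι-<⇒<-leftAdj a y (ιa≤y , ιa≢y) =
    ι-reflects-≤ a (ℓ y) (B.≤-trans ιa≤y (≤-ι-leftAdj y)) ,
    λ a≡ℓy → ιa≢y (B.antisym ιa≤y (subst (λ w → y ≤₁ ι e w) (sym a≡ℓy) (≤-ι-leftAdj y)))

  <-leftAdj⇒ι-< : ∀ a y → _<_ I₀ a (ℓ y) → _<_ I₁ (ι e a) y
  <-leftAdj⇒ι-< a y (a≤ℓy , a≢ℓy) with B.total (ι e a) y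
  ... | inj₁ ιa≤y = ιa≤y , λ ιa≡y → a≢ℓy (A.antisym a≤ℓy (≤-ι⇒leftAdj-≤ y a (B.reflexive (sym ιa≡y))))
  ... | inj₂ y≤ιa = ⊥-elim (a≢ℓy (A.antisym a≤ℓy (≤-ι⇒leftAdj-≤ y a y≤ιa)))

  ⋁-leftAdj-preimage : ∀ (D : C₀ → Set) → ⋁ I₁ (D ∘ ℓ) ≡ ι e (⋁ I₀ D)
  ⋁-leftAdj-preimage D = B.antisym
    (⋁-least I₁ _ _ λ y dℓy →
      B.≤-trans (≤-ι-leftAdj y) (ι-monotone _ _ (⋁-upper I₀ D (ℓ y) dℓy)))
    (subst (_≤₁ ⋁ I₁ (D ∘ ℓ)) (sym (pres-joins e D))
      (⋁-least I₁ _ _ λ { z (x , dx , refl) →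
        ⋁-upper I₁ _ (ι e x) (subst D (sym (leftAdj-ι x)) dx) }))

  restrict : (C₁ → C₁) → C₀ → C₀
  restrict k = ℓ ∘ k ∘ ι e

  restrict-R : ∀ f → restrict (R e f) ≗ f
  restrict-R f x = trans (leftAdj-ι _) (cong f (leftAdj-ι x))

  restrict-joinPreserving : ∀ k → PreservesJoins I₁ k → PreservesJoins I₀ (restrict k)
  restrict-joinPreserving k k-joins =
    ∘-joinPreserving {I₀} {I₁} {I₀} {k ∘ ι e} {ℓ}
      (∘-joinPreserving {I₀} {I₁} {I₁} {ι e} {k} (pres-joins e) k-joins)
      leftAdj-joinPreserving

  R-joinPreserving : ∀ f → PreservesJoins I₀ f → PreservesJoins I₁ (R e f)
  R-joinPreserving f f-joins =
    ∘-joinPreserving {I₁} {I₀} {I₁} {f ∘ ℓ} {ι e}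
      (∘-joinPreserving {I₁} {I₀} {I₀} {ℓ} {f} leftAdj-joinPreserving f-joins)
      (pres-joins e)

  R-injective : ∀ f g → R e f ≗ R e g → f ≗ g
  R-injective f g Rf≗Rg x = begin
    f x                ≡⟨ restrict-R f x ⟨
    restrict (R e f) x ≡⟨ cong ℓ (Rf≗Rg (ι e x)) ⟩
    restrict (R e g) x ≡⟨ restrict-R g x ⟩
    g x                ∎
    where open ≡-Reasoning

  R-monotone : ∀ f g → _≤ᶠ_ I₀ f g → _≤ᶠ_ I₁ (R e f) (R e g)
  R-monotone f g f≤g y = ι-monotone _ _ (f≤g (ℓ y))

  ≤-R⇒restrict-≤ : ∀ k f → _≤ᶠ_ I₁ k (R e f) → _≤ᶠ_ I₀ (restrict k) f
  ≤-R⇒restrict-≤ k f k≤Rf x = subst (restrict k x ≤₀_) (restrict-R f x)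
    (leftAdj-monotone _ _ (k≤Rf (ι e x)))

  restrict-≤⇒≤-R : ∀ k h → PreservesJoins I₁ k →
                   _≤ᶠ_ I₀ (restrict k) h → _≤ᶠ_ I₁ k (R e h)
  restrict-≤⇒≤-R k h k-joins restrict-k≤h y = B.≤-trans
    (joinPreserving⇒monotone {I₁} {I₁} {k} k-joins _ _ (≤-ι-leftAdj y))
    (leftAdj-≤⇒≤-ι _ _ (restrict-k≤h (ℓ y)))

  R-⊗ : ∀ f g → R e (_⊗_ I₀ f g) ≗ _⊗_ I₁ (R e f) (R e g)
  R-⊗ f g y = cong (ι e ∘ g) (sym (leftAdj-ι _))

  R-* : ∀ h → _* I₁ (R e h) ≗ R e (_* I₀ h)
  R-* h y = trans
    (B.⋁-cong _ _ (λ _ → ι-<⇒<-leftAdj _ y) (λ _ → <-leftAdj⇒ι-< _ y))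
    (⋁-leftAdj-preimage (λ x → _<_ I₀ (h x) (ℓ y)))

  R-⊕ : ∀ f g → R e (_⊕_ I₀ f g) ≗ _⊕_ I₁ (R e f) (R e g)
  R-⊕ f g y = begin
    R e (_* I₀ (_⊗_ I₀ (_* I₀ g) (_* I₀ f))) y       ≡⟨ R-* _ y ⟨
    _* I₁ (R e (_⊗_ I₀ (_* I₀ g) (_* I₀ f))) y       ≡⟨ *-cong I₁ (R-⊗ (_* I₀ g) (_* I₀ f)) y ⟩
    _* I₁ (_⊗_ I₁ (R e (_* I₀ g)) (R e (_* I₀ f))) y ≡⟨ *-cong I₁ (⊗-cong I₁ (sym ∘ R-* g) (sym ∘ R-* f)) y ⟩
    _* I₁ (_⊗_ I₁ (_* I₁ (R e g)) (_* I₁ (R e f))) y ∎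
    where open ≡-Reasoning

  R-meet : ∀ f g h → IsMeetQ I₀ f g h → IsMeetQ I₁ (R e f) (R e g) (R e h)
  R-meet f g h (h-joins , h≤f , h≤g , h-greatest) =
    R-joinPreserving h h-joins , R-monotone h f h≤f , R-monotone h g h≤g ,
    λ k k-joins k≤Rf k≤Rg → restrict-≤⇒≤-R k h k-joins
      (h-greatest (restrict k) (restrict-joinPreserving k k-joins)
        (≤-R⇒restrict-≤ k f k≤Rf) (≤-R⇒restrict-≤ k g k≤Rg))

  R-top : ∀ h → IsTopQ I₀ h → IsTopQ I₁ (R e h)
  R-top h (h-joins , h-greatest) =
    R-joinPreserving h h-joins ,
    λ k k-joins → restrict-≤⇒≤-R k h k-joins
      (h-greatest (restrict k) (restrict-joinPreserving k k-joins))

  R-join : ∀ f g h → PreservesJoins I₀ f → PreservesJoins I₀ g →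
           IsJoinQ I₀ f g h → IsJoinQ I₁ (R e f) (R e g) (R e h)
  R-join f g h f-joins g-joins (h-joins , f≤h , g≤h , h-least) =
    R-joinPreserving h h-joins , R-monotone f h f≤h , R-monotone g h g≤h ,
    λ k _ Rf≤k Rg≤k y → B.≤-trans
      (R-monotone h (λ x → f x A.⊔ g x) h≤f⊔g y)
      (subst (_≤₁ k y) (sym (joinPreserving-⊔ {I₀} {I₁} {ι e} (pres-joins e) _ _))
        (B.⊔-least _ _ _ (Rf≤k y) (Rg≤k y)))
    where
    h≤f⊔g : _≤ᶠ_ I₀ h (λ x → f x A.⊔ g x)
    h≤f⊔g = h-least _ (⊔ᶠ-joinPreserving I₀ f-joins g-joins)
      (λ x → A.x≤x⊔y _ _) (λ x → A.y≤x⊔y _ _)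

  R-bot : ∀ h → IsBotQ I₀ h → IsBotQ I₁ (R e h)
  R-bot h (h-joins , h-least) =
    R-joinPreserving h h-joins ,
    λ k _ y → B.≤-trans
      (R-monotone h (λ _ → A.⊥ᴵ) (h-least _ (const-⊥-joinPreserving I₀)) y)
      (subst (_≤₁ k y) (sym (joinPreserving-⊥ {I₀} {I₁} {ι e} (pres-joins e)))
        (B.⊥ᴵ-least (k y)))

idEmbedding : ∀ I → ChainEmbedding I I
idEmbedding I = record
  { ι          = id
  ; injective  = id
  ; pres-joins = λ P → ⋁-cong _ _ (λ x px → x , px , refl) λ { z (x , px , refl) → px }
  ; pres-meets = λ P → ⋀-cong _ _ (λ x px → x , px , refl) λ { z (x , px , refl) → px }
  }
  where open ChainProperties I

R-id : ∀ I f → R (idEmbedding I) f ≗ f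
R-id I f y = cong f (ChainProperties.⋀-≤-upwardClosure I y)

infixr 9 _∘ᵉ_

_∘ᵉ_ : ∀ {I₀ I₁ I₂} → ChainEmbedding I₁ I₂ → ChainEmbedding I₀ I₁ → ChainEmbedding I₀ I₂
_∘ᵉ_ {I₀} {I₁} {I₂} e₂ e₁ = record
  { ι          = ι e₂ ∘ ι e₁
  ; injective  = injective e₁ ∘ injective e₂
  ; pres-joins = ∘-joinPreserving {I₀} {I₁} {I₂} {ι e₁} {ι e₂} (pres-joins e₁) (pres-joins e₂)
  ; pres-meets = ∘-meetPreserving {I₀} {I₁} {I₂} {ι e₁} {ι e₂} (pres-meets e₁) (pres-meets e₂)
  }

leftAdj-∘ : ∀ {I₀ I₁ I₂} (e₂ : ChainEmbedding I₁ I₂) (e₁ : ChainEmbedding I₀ I₁) →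
            leftAdj (e₂ ∘ᵉ e₁) ≗ leftAdj e₁ ∘ leftAdj e₂
leftAdj-∘ {I₀} e₂ e₁ z = ChainProperties.⋀-cong I₀ _ _
  (λ x → Embedding.≤-ι⇒leftAdj-≤ e₂ z (ι e₁ x))
  (λ x → Embedding.leftAdj-≤⇒≤-ι e₂ z (ι e₁ x))

R-∘ : ∀ {I₀ I₁ I₂} (e₂ : ChainEmbedding I₁ I₂) (e₁ : ChainEmbedding I₀ I₁) f →
      R (e₂ ∘ᵉ e₁) f ≗ R e₂ (R e₁ f)
R-∘ e₂ e₁ f z = cong (ι e₂ ∘ ι e₁ ∘ f) (leftAdj-∘ e₂ e₁ z)

mainTheorem15 :
    -- (1) R_ι is an embedding of lattice-ordered bisemigroups Q_∨(I₀) → Q_∨(I₁)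
    (∀ (I₀ I₁ : CompleteChain) → Perfect I₀ → Perfect I₁ →
      (e : ChainEmbedding I₀ I₁) →
      (∀ f → PreservesJoins I₀ f → PreservesJoins I₁ (R e f))
      × (∀ f g → PreservesJoins I₀ f → PreservesJoins I₀ g →
           R e f ≗ R e g → f ≗ g)
      × (∀ f g h → PreservesJoins I₀ f → PreservesJoins I₀ g →
           IsMeetQ I₀ f g h → IsMeetQ I₁ (R e f) (R e g) (R e h))
      × (∀ f g h → PreservesJoins I₀ f → PreservesJoins I₀ g →
           IsJoinQ I₀ f g h → IsJoinQ I₁ (R e f) (R e g) (R e h))
      × (∀ h → IsTopQ I₀ h → IsTopQ I₁ (R e h))
      × (∀ h → IsBotQ I₀ h → IsBotQ I₁ (R e h))
      × (∀ f g → PreservesJoins I₀ f → PreservesJoins I₀ g →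
           R e (_⊗_ I₀ f g) ≗ _⊗_ I₁ (R e f) (R e g))
      × (∀ f g → PreservesJoins I₀ f → PreservesJoins I₀ g →
           R e (_⊕_ I₀ f g) ≗ _⊕_ I₁ (R e f) (R e g)))
    -- (2) identities: id is such an embedding and R_id = id
    × (∀ (I₀ : CompleteChain) → Perfect I₀ →
      Σ (ChainEmbedding I₀ I₀) λ e → (∀ x → ι e x ≡ x) ×
        (∀ f → PreservesJoins I₀ f → R e f ≗ f))
    -- (3) composition: ι₂ ∘ ι₁ is such an embedding and R_{ι₂∘ι₁} = R_{ι₂} ∘ R_{ι₁}
    × (∀ (I₀ I₁ I₂ : CompleteChain) → Perfect I₀ → Perfect I₁ → Perfect I₂ →
      (e₁ : ChainEmbedding I₀ I₁) → (e₂ : ChainEmbedding I₁ I₂) →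
      Σ (ChainEmbedding I₀ I₂) λ e → (∀ x → ι e x ≡ ι e₂ (ι e₁ x)) ×
        (∀ f → PreservesJoins I₀ f → R e f ≗ R e₂ (R e₁ f)))
mainTheorem15 =
  (λ I₀ I₁ _ _ e → let open Embedding e in
    R-joinPreserving ,
    (λ f g _ _ → R-injective f g) ,
    (λ f g h _ _ → R-meet f g h) ,
    R-join ,
    R-top ,
    R-bot ,
    (λ f g _ _ → R-⊗ f g) ,
    (λ f g _ _ → R-⊕ f g)) ,
  (λ I _ → idEmbedding I , (λ _ → refl) , λ f _ → R-id I f) ,
  (λ I₀ I₁ I₂ _ _ _ e₁ e₂ → e₂ ∘ᵉ e₁ , (λ _ → refl) , λ f _ → R-∘ e₂ e₁ f)
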